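{- Let $v^{(\ell)}_j$ ($\ell \ge 0$, $0 \le j \le 2^{\ell+1}-1$) be the rational numbers defined by $v^{(0)}_0 = 1$, $v^{(0)}_1 = 1$, and, for $\ell \ge 1$, $$v^{(\ell)}_0 = 1,\quad v^{(\ell)}_1 = 2,\quad v^{(\ell)}_{2j} = -\frac{v^{(\ell-1)}_j}{v^{(\ell)}_{2j-1}},\quad v^{(\ell)}_{2j+1} = 1 + (-1)^j - v^{(\ell)}_{2j}\qquad (1 \le j \le 2^\ell - 1).$$ For $\ell \ge 0$ let $g_\ell(z) = \frac{1}{z}\prod_{h=0}^{\ell}(1 - z^{ -2^h}) \in \mathbb{Q}(z)$. Then, for every $\ell \ge 0$, $$g_\ell(z) = \cfrac{v^{(\ell)}_0}{z+1 + \cfrac{v^{(\ell)}_1}{z-1 + \cfrac{v^{(\ell)}_2}{z+1 + \cfrac{\ddots}{\ddots + \cfrac{v^{(\ell)}_{2^{\ell+1}-1}}{z-1}}}}},$$ where the $j$-th denominator (for $j = 0, 1, \ldots, 2^{\ell+1}-1$) is $z+1$ if $j$ is even and $z-1$ if $j$ is odd. Moreover, for every $\ell \ge 0$, all the partial quotients $a_i(z) \in \mathbb{Q}[z]$ in the continued fraction expansion $g_\ell(z) = [0; a_1(z), \ldots, a_m(z)] = \cfrac{1}{a_1(z) + \cfrac{1}{\ddots + \cfrac{1}{a_m(z)}}}$ are polynomials of degree one. -}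

module Defs where

open import Data.Bool using (Bool; true; false; not; if_then_else_)
open import Data.Nat as ℕ using (ℕ; zero; suc; _^_)
open import Data.List using (List; []; _∷_; map; replicate; _++_; length; zip)
open import Data.List.Relation.Unary.All using (All)
open import Data.Maybe using (Maybe; just; nothing; _>>=_)
open import Data.Product using (_×_; _,_)
open import Data.Rational using (ℚ; 0ℚ; 1ℚ; _+_; _*_; -_; _-_; _÷_; ≢-nonZero)
open import Data.Rational.Properties using (_≟_)
open import Relation.Nullary using (yes; no; does)
open import Relation.Binary.PropositionalEquality using (_≡_)

-- Polynomials in ℚ[z]: coefficient lists, lowest degree first
-- (not necessarily normalised; trailing zeros allowed).

Poly : Set
Poly = List ℚ

infixl 6 _+P_ _-P_
infixl 7 _*P_

_+P_ : Poly → Poly → Poly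
[] +P q = q
(a ∷ p) +P [] = a ∷ p
(a ∷ p) +P (b ∷ q) = (a + b) ∷ (p +P q)

scaleP : ℚ → Poly → Poly
scaleP c p = map (c *_) p

negP : Poly → Poly
negP p = map -_ p

_-P_ : Poly → Poly → Poly
p -P q = p +P negP q

_*P_ : Poly → Poly → Poly
[] *P q = []
(a ∷ p) *P q = scaleP a q +P (0ℚ ∷ (p *P q))

constP : ℚ → Poly
constP c = c ∷ []

zP : Poly
zP = 0ℚ ∷ 1ℚ ∷ []

zPow : ℕ → Poly
zPow n = replicate n 0ℚ ++ (1ℚ ∷ [])

consN : ℚ → Poly → Poly
consN a [] = if does (a ≟ 0ℚ) then [] else (a ∷ [])
consN a (b ∷ q) = a ∷ b ∷ q

norm : Poly → Poly
norm [] = []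
norm (a ∷ p) = consN a (norm p)

_≈P_ : Poly → Poly → Set
p ≈P q = norm p ≡ norm q

isZeroP : Poly → Bool
isZeroP p with norm p
... | [] = true
... | _ ∷ _ = false

DegreeOne : Poly → Set
DegreeOne p = length (norm p) ≡ 2

-- Elements of ℚ(z), represented as fractions num/den
-- (den is a nonzero polynomial in all uses below).

record RF : Set where
  constructor _/ᶠ_
  field
    num : Poly
    den : Poly
open RF public

_≈RF_ : RF → RF → Set
f ≈RF g = (num f *P den g) ≈P (num g *P den f)

oneRF : RF
oneRF = constP 1ℚ /ᶠ constP 1ℚ

mulRF : RF → RF → RF
mulRF (p /ᶠ q) (r /ᶠ s) = (p *P r) /ᶠ (q *P s)

subRF : RF → RF → RF
subRF (p /ᶠ q) (r /ᶠ s) = ((p *P s) -P (r *P q)) /ᶠ (q *P s)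

zPowInv : ℕ → RF
zPowInv n = constP 1ℚ /ᶠ zPow n

zInv : RF
zInv = constP 1ℚ /ᶠ zP

factor : ℕ → RF
factor h = subRF oneRF (zPowInv (2 ^ h))

prodFactors : ℕ → RF
prodFactors zero = factor zero
prodFactors (suc ℓ) = mulRF (prodFactors ℓ) (factor (suc ℓ))

g : ℕ → RF
g ℓ = mulRF zInv (prodFactors ℓ)

-- Finite continued fractions
--   b₀/(d₀ + b₁/(d₁ + ⋯ + bₘ/dₘ))
-- evaluated bottom-up in ℚ(z).  The result is `nothing` if some
-- denominator d_j + (tail) is the zero rational function (i.e. the
-- continued fraction is undefined).  The empty continued fraction is 0.

cfEval : List (Poly × Poly) → Maybe RF
cfEval [] = just ([] /ᶠ constP 1ℚ)
cfEval ((b , d) ∷ rest) = cfEval rest >>= λ where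
  (p /ᶠ q) → let D = (d *P q) +P p in
    if isZeroP D then nothing else just ((b *P q) /ᶠ D)

cfTerms : Bool → List ℚ → List (Poly × Poly)
cfTerms even [] = []
cfTerms even (v ∷ vs) =
  (constP v , (if even then zP +P constP 1ℚ else zP -P constP 1ℚ))
    ∷ cfTerms (not even) vs

cf0 : List Poly → Maybe RF
cf0 as = cfEval (map (λ a → (constP 1ℚ , a)) as)

-- The numbers v^{(ℓ)}_j, as the list [v^{(ℓ)}_0, …, v^{(ℓ)}_{2^{ℓ+1}-1}].
-- Division is partial: `nothing` signals division by zero, so
-- `vals ℓ ≡ just vs` asserts that the recursion is well defined.

divQ : ℚ → ℚ → Maybe ℚ
divQ x y with y ≟ 0ℚ
... | yes _ = nothing
... | no y≢0 = just (_÷_ x y {{≢-nonZero y≢0}})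

-- 1 + (-1)^j, given whether j is even
onePlusSign : Bool → ℚ
onePlusSign true = 1ℚ + 1ℚ
onePlusSign false = 0ℚ

-- step jEven o (v^{(ℓ-1)}_j ∷ v^{(ℓ-1)}_{j+1} ∷ …), where o = v^{(ℓ)}_{2j-1},
-- produces v^{(ℓ)}_{2j}, v^{(ℓ)}_{2j+1}, v^{(ℓ)}_{2j+2}, …
step : Bool → ℚ → List ℚ → Maybe (List ℚ)
step jEven o [] = just []
step jEven o (x ∷ xs) = divQ (- x) o >>= λ e →
  let o' = onePlusSign jEven - e in
  step (not jEven) o' xs >>= λ rest → just (e ∷ o' ∷ rest)

-- level ℓ ≥ 1 from level ℓ-1 (v^{(ℓ)}_0 = 1, v^{(ℓ)}_1 = 2, then j = 1, 2, …)
nextLevel : List ℚ → Maybe (List ℚ)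
nextLevel [] = nothing
nextLevel (_ ∷ ps) = step false (1ℚ + 1ℚ) ps >>= λ rest → just (1ℚ ∷ (1ℚ + 1ℚ) ∷ rest)

vals : ℕ → Maybe (List ℚ)
vals zero = just (1ℚ ∷ 1ℚ ∷ [])
vals (suc ℓ) = vals ℓ >>= nextLevel

-- Since g_{ℓ+1}(z) = (z − 1)·g_ℓ(z²), it suffices that one level of the recursion for v
-- realises f(z) ↦ (z − 1)·f(z²) on continued fractions.  Contracting the continued fraction
-- of level ℓ + 1 over pairs of consecutive terms gives that of level ℓ in z²: (z + 1)(z − 1)
-- = z² − 1, and the summand 1 + (−1)^j turns this into the denominator z² ± 1 of level ℓ.
-- This holds on the nose for numerators and denominators, which are therefore
-- ∏_{h ≤ ℓ} (z^{2^h} − 1) and z^{2^{ℓ+1}}.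
--
-- The recursion never divides by zero: 2-adically, after its initial 1, 2 each level ℓ ≥ 1
-- is a sequence of units and of pairs of numbers of valuation −1, and this shape
-- reproduces itself.  A continued fraction with j constant numerators and linear
-- denominators has a denominator of degree exactly j, so it never meets a zero
-- denominator, and the equivalence transformation with scalars cⱼ = (vⱼ cⱼ₋₁)⁻¹ turns it
-- into [0; c₀(z + 1), c₁(z − 1), …], whose partial quotients are linear.

module Submission where

open import Defs
open import Agda.Primitive using (lzero)
open import Algebra.Bundles using (CommutativeRing)
open import Data.Bool using (Bool; true; false; not; if_then_else_)
open import Data.Empty using (⊥; ⊥-elim)
open import Data.Integer as ℤ using (ℤ; +_; -[1+_]; 0ℤ)
import Data.Integer.Properties as ℤ
import Data.Integer.Tactic.RingSolver as ℤ-Solver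
open import Data.List using (List; []; _∷_; length; map)
open import Data.List.Relation.Unary.All as All using (All; []; _∷_)
open import Data.Maybe using (just; nothing)
open import Data.Nat as ℕ using (ℕ; zero; suc; _^_)
import Data.Nat.Properties as ℕ
open import Data.Product using (Σ; _×_; _,_; ∃-syntax; proj₁; proj₂; uncurry)
open import Data.Rational using (ℚ; 0ℚ; 1ℚ; ½; -½; _+_; _*_; -_; _-_; 1/_; ↥_; ≢-nonZero)
open import Data.Rational.Literals using (fromℤ)
import Data.Rational.Properties as ℚ
import Data.Rational.Unnormalised as ℚᵘ
import Data.Rational.Unnormalised.Properties as ℚᵘ
open import Data.Unit using (⊤)
open import Function using (_∘_)
open import Relation.Binary.Bundles using (Setoid)
open import Relation.Binary.PropositionalEquality
open import Relation.Binary.Structures using (IsEquivalence)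
import Relation.Binary.Reasoning.Setoid as SetoidReasoning
open import Relation.Nullary using (¬_; Dec; yes; no; contradiction)
import Relation.Nullary.Decidable as Dec
open import Relation.Nullary.Decidable using (True; toWitness)
open import Tactic.RingSolver using (solve-∀)
open import Tactic.RingSolver.Core.AlmostCommutativeRing using (AlmostCommutativeRing; fromCommutativeRing)

open import Algebra.Apartness.Properties.HeytingCommutativeRing ℚ.heytingCommutativeRing
  using (x#0y#0→xy#0)

-- Polynomial arithmetic

infix 4 _≋_ _≋?_

-- Equality of coefficient lists up to trailing zeros: an inductive presentation of _≈P_
-- (see ≋⇒≈P) that makes Poly a commutative ring.
data _≋_ : Poly → Poly → Set where
  []     : [] ≋ []
  _∷_    : ∀ {a b p q} → a ≡ b → p ≋ q → a ∷ p ≋ b ∷ q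
  ≋-padˡ : ∀ {b q} → 0ℚ ≡ b → [] ≋ q → [] ≋ b ∷ q
  ≋-padʳ : ∀ {a p} → a ≡ 0ℚ → p ≋ [] → a ∷ p ≋ []

≋-refl : ∀ {p} → p ≋ p
≋-refl {[]}    = []
≋-refl {a ∷ p} = refl ∷ ≋-refl

≋-reflexive : ∀ {p q} → p ≡ q → p ≋ q
≋-reflexive refl = ≋-refl

≋-sym : ∀ {p q} → p ≋ q → q ≋ p
≋-sym []           = []
≋-sym (e ∷ h)      = sym e ∷ ≋-sym h
≋-sym (≋-padˡ e h) = ≋-padʳ (sym e) (≋-sym h)
≋-sym (≋-padʳ e h) = ≋-padˡ (sym e) (≋-sym h)

≋-trans : ∀ {p q r} → p ≋ q → q ≋ r → p ≋ r
≋-trans []             h              = h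
≋-trans (e₁ ∷ h₁)      (e₂ ∷ h₂)      = trans e₁ e₂ ∷ ≋-trans h₁ h₂
≋-trans (e₁ ∷ h₁)      (≋-padʳ e₂ h₂) = ≋-padʳ (trans e₁ e₂) (≋-trans h₁ h₂)
≋-trans (≋-padˡ e₁ h₁) (e₂ ∷ h₂)      = ≋-padˡ (trans e₁ e₂) (≋-trans h₁ h₂)
≋-trans (≋-padˡ e₁ h₁) (≋-padʳ e₂ h₂) = []
≋-trans (≋-padʳ e₁ h₁) []             = ≋-padʳ e₁ h₁
≋-trans (≋-padʳ e₁ h₁) (≋-padˡ e₂ h₂) = trans e₁ e₂ ∷ ≋-trans h₁ h₂

0∷-cong : ∀ {p q} → p ≋ q → 0ℚ ∷ p ≋ 0ℚ ∷ q
0∷-cong = refl ∷_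

≋-isEquivalence : IsEquivalence _≋_
≋-isEquivalence = record { refl = ≋-refl ; sym = ≋-sym ; trans = ≋-trans }

≋-setoid : Setoid lzero lzero
≋-setoid = record { isEquivalence = ≋-isEquivalence }

_≋?_ : (p q : Poly) → Dec (p ≋ q)
[]      ≋? []      = yes []
[]      ≋? (b ∷ q) =
  Dec.map′ (uncurry ≋-padˡ) (λ { (≋-padˡ e h) → e , h }) ((0ℚ ℚ.≟ b) Dec.×-dec ([] ≋? q))
(a ∷ p) ≋? []      =
  Dec.map′ (uncurry ≋-padʳ) (λ { (≋-padʳ e h) → e , h }) ((a ℚ.≟ 0ℚ) Dec.×-dec (p ≋? []))
(a ∷ p) ≋? (b ∷ q) =
  Dec.map′ (uncurry _∷_) (λ { (e ∷ h) → e , h }) ((a ℚ.≟ b) Dec.×-dec (p ≋? q))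

≋-byComputation : ∀ p q {_ : True (p ≋? q)} → p ≋ q
≋-byComputation p q {t} = toWitness t

+P-identityʳ : ∀ p → p +P [] ≡ p
+P-identityʳ []      = refl
+P-identityʳ (a ∷ p) = refl

+P-comm : ∀ p q → p +P q ≡ q +P p
+P-comm []      q       = sym (+P-identityʳ q)
+P-comm (a ∷ p) []      = refl
+P-comm (a ∷ p) (b ∷ q) = cong₂ _∷_ (ℚ.+-comm a b) (+P-comm p q)

+P-assoc : ∀ p q r → (p +P q) +P r ≡ p +P (q +P r)
+P-assoc []      q       r       = refl
+P-assoc (a ∷ p) []      r       = refl
+P-assoc (a ∷ p) (b ∷ q) []      = refl
+P-assoc (a ∷ p) (b ∷ q) (c ∷ r) = cong₂ _∷_ (ℚ.+-assoc a b c) (+P-assoc p q r)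

+P-congʳ : ∀ {p p′} q → p ≋ p′ → p +P q ≋ p′ +P q
+P-congʳ q       []           = ≋-refl
+P-congʳ []      (e ∷ h)      = e ∷ h
+P-congʳ (c ∷ q) (e ∷ h)      = cong (_+ c) e ∷ +P-congʳ q h
+P-congʳ []      (≋-padˡ e h) = ≋-padˡ e h
+P-congʳ (c ∷ q) (≋-padˡ e h) = trans (sym (ℚ.+-identityˡ c)) (cong (_+ c) e) ∷ +P-congʳ q h
+P-congʳ []      (≋-padʳ e h) = ≋-padʳ e h
+P-congʳ (c ∷ q) (≋-padʳ e h) = trans (cong (_+ c) e) (ℚ.+-identityˡ c) ∷ +P-congʳ q h

+P-cong : ∀ {p p′ q q′} → p ≋ p′ → q ≋ q′ → p +P q ≋ p′ +P q′
+P-cong {p} {p′} {q} {q′} p≋p′ q≋q′ = ≋-trans (+P-congʳ q p≋p′) (≋-trans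
  (≋-reflexive (+P-comm p′ q)) (≋-trans (+P-congʳ p′ q≋q′) (≋-reflexive (+P-comm q′ p′))))

+P-congˡ : ∀ p {q q′} → q ≋ q′ → p +P q ≋ p +P q′
+P-congˡ p = +P-cong (≋-refl {p})

negP-inverseʳ : ∀ p → p +P negP p ≋ []
negP-inverseʳ []      = []
negP-inverseʳ (a ∷ p) = ≋-padʳ (ℚ.+-inverseʳ a) (negP-inverseʳ p)

negP-cong : ∀ {p q} → p ≋ q → negP p ≋ negP q
negP-cong []           = []
negP-cong (e ∷ h)      = cong -_ e ∷ negP-cong h
negP-cong (≋-padˡ e h) = ≋-padˡ (cong -_ e) (negP-cong h)
negP-cong (≋-padʳ e h) = ≋-padʳ (cong -_ e) (negP-cong h)

scaleP-congʳ : ∀ c {p q} → p ≋ q → scaleP c p ≋ scaleP c q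
scaleP-congʳ c []           = []
scaleP-congʳ c (e ∷ h)      = cong (c *_) e ∷ scaleP-congʳ c h
scaleP-congʳ c (≋-padˡ e h) = ≋-padˡ (trans (sym (ℚ.*-zeroʳ c)) (cong (c *_) e)) (scaleP-congʳ c h)
scaleP-congʳ c (≋-padʳ e h) = ≋-padʳ (trans (cong (c *_) e) (ℚ.*-zeroʳ c)) (scaleP-congʳ c h)

scaleP-distrib-+P : ∀ c p q → scaleP c (p +P q) ≡ scaleP c p +P scaleP c q
scaleP-distrib-+P c []      q       = refl
scaleP-distrib-+P c (a ∷ p) []      = refl
scaleP-distrib-+P c (a ∷ p) (b ∷ q) = cong₂ _∷_ (ℚ.*-distribˡ-+ c a b) (scaleP-distrib-+P c p q)

scaleP-distrib-+ : ∀ a b p → scaleP (a + b) p ≡ scaleP a p +P scaleP b p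
scaleP-distrib-+ a b []      = refl
scaleP-distrib-+ a b (x ∷ p) = cong₂ _∷_ (ℚ.*-distribʳ-+ x a b) (scaleP-distrib-+ a b p)

scaleP-assoc : ∀ a b p → scaleP a (scaleP b p) ≡ scaleP (a * b) p
scaleP-assoc a b []      = refl
scaleP-assoc a b (x ∷ p) = cong₂ _∷_ (sym (ℚ.*-assoc a b x)) (scaleP-assoc a b p)

scaleP-zero : ∀ p → scaleP 0ℚ p ≋ []
scaleP-zero []      = []
scaleP-zero (x ∷ p) = ≋-padʳ (ℚ.*-zeroˡ x) (scaleP-zero p)

scaleP-identity : ∀ p → scaleP 1ℚ p ≡ p
scaleP-identity []      = refl
scaleP-identity (x ∷ p) = cong₂ _∷_ (ℚ.*-identityˡ x) (scaleP-identity p)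

+P-[0]ʳ : ∀ p → p +P (0ℚ ∷ []) ≋ p
+P-[0]ʳ []      = ≋-padʳ refl []
+P-[0]ʳ (a ∷ p) = ℚ.+-identityʳ a ∷ ≋-reflexive (+P-identityʳ p)

constP-*P : ∀ c p → constP c *P p ≋ scaleP c p
constP-*P c p = +P-[0]ʳ (scaleP c p)

constP-* : ∀ a b → constP (a * b) ≋ constP a *P constP b
constP-* a b = sym (ℚ.+-identityʳ (a * b)) ∷ []

*P-zeroʳ : ∀ p → p *P [] ≋ []
*P-zeroʳ []      = []
*P-zeroʳ (a ∷ p) = ≋-padʳ refl (*P-zeroʳ p)

*P-congʳ : ∀ {p p′} q → p ≋ p′ → p *P q ≋ p′ *P q
*P-congʳ q []                      = []
*P-congʳ q (_∷_ {a = a} refl h)    = +P-congˡ (scaleP a q) (0∷-cong (*P-congʳ q h))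
*P-congʳ q (≋-padˡ refl h) = ≋-sym (+P-cong (scaleP-zero q) (≋-padʳ refl (≋-sym (*P-congʳ q h))))
*P-congʳ q (≋-padʳ refl h) = +P-cong (scaleP-zero q) (≋-padʳ refl (*P-congʳ q h))

0∷-*P : ∀ p q → (0ℚ ∷ p) *P q ≋ 0ℚ ∷ p *P q
0∷-*P p q = +P-congʳ (0ℚ ∷ p *P q) (scaleP-zero q)

+P-interchange : ∀ a b c d → (a +P b) +P (c +P d) ≡ (a +P c) +P (b +P d)
+P-interchange a b c d = begin
  (a +P b) +P (c +P d) ≡⟨ +P-assoc a b (c +P d) ⟩
  a +P (b +P (c +P d)) ≡⟨ cong (a +P_) (sym (+P-assoc b c d)) ⟩
  a +P ((b +P c) +P d) ≡⟨ cong (λ x → a +P (x +P d)) (+P-comm b c) ⟩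
  a +P ((c +P b) +P d) ≡⟨ cong (a +P_) (+P-assoc c b d) ⟩
  a +P (c +P (b +P d)) ≡⟨ sym (+P-assoc a c (b +P d)) ⟩
  (a +P c) +P (b +P d) ∎
  where open ≡-Reasoning

*P-distribʳ : ∀ p p′ q → (p +P p′) *P q ≋ p *P q +P p′ *P q
*P-distribʳ []      p′       q = ≋-refl
*P-distribʳ (a ∷ p) []       q = ≋-reflexive (sym (+P-identityʳ _))
*P-distribʳ (a ∷ p) (b ∷ p′) q = ≋-trans
  (+P-cong (≋-reflexive (scaleP-distrib-+ a b q)) (0∷-cong (*P-distribʳ p p′ q)))
  (≋-reflexive (+P-interchange (scaleP a q) (scaleP b q) (0ℚ ∷ p *P q) (0ℚ ∷ p′ *P q)))

*P-∷ʳ : ∀ p b q → p *P (b ∷ q) ≋ scaleP b p +P (0ℚ ∷ p *P q)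
*P-∷ʳ []      b q = ≋-padˡ refl []
*P-∷ʳ (a ∷ p) b q =
  trans (ℚ.+-identityʳ (a * b)) (trans (ℚ.*-comm a b) (sym (ℚ.+-identityʳ (b * a)))) ∷
  ≋-trans (+P-cong ≋-refl (*P-∷ʳ p b q)) (≋-reflexive (begin
    scaleP a q +P (scaleP b p +P (0ℚ ∷ p *P q))   ≡⟨ sym (+P-assoc (scaleP a q) (scaleP b p) _) ⟩
    (scaleP a q +P scaleP b p) +P (0ℚ ∷ p *P q)   ≡⟨ cong (_+P (0ℚ ∷ p *P q)) (+P-comm (scaleP a q) (scaleP b p)) ⟩
    (scaleP b p +P scaleP a q) +P (0ℚ ∷ p *P q)   ≡⟨ +P-assoc (scaleP b p) (scaleP a q) _ ⟩
    scaleP b p +P (scaleP a q +P (0ℚ ∷ p *P q))   ∎))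
  where open ≡-Reasoning

*P-comm : ∀ p q → p *P q ≋ q *P p
*P-comm []      q = ≋-sym (*P-zeroʳ q)
*P-comm (a ∷ p) q = ≋-trans (+P-congˡ (scaleP a q) (0∷-cong (*P-comm p q))) (≋-sym (*P-∷ʳ q a p))

*P-cong : ∀ {p p′ q q′} → p ≋ p′ → q ≋ q′ → p *P q ≋ p′ *P q′
*P-cong {p} {p′} {q} {q′} p≋p′ q≋q′ = ≋-trans (*P-congʳ q p≋p′)
  (≋-trans (*P-comm p′ q) (≋-trans (*P-congʳ p′ q≋q′) (*P-comm q′ p′)))

*P-congˡ : ∀ p {q q′} → q ≋ q′ → p *P q ≋ p *P q′
*P-congˡ p = *P-cong (≋-refl {p})

*P-distribˡ : ∀ q p p′ → q *P (p +P p′) ≋ q *P p +P q *P p′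
*P-distribˡ q p p′ = ≋-trans (*P-comm q (p +P p′))
  (≋-trans (*P-distribʳ p p′ q) (+P-cong (*P-comm p q) (*P-comm p′ q)))

scaleP-*P : ∀ a p q → scaleP a p *P q ≋ scaleP a (p *P q)
scaleP-*P a []      q = []
scaleP-*P a (b ∷ p) q = ≋-trans
  (+P-cong (≋-reflexive (sym (scaleP-assoc a b q))) (sym (ℚ.*-zeroʳ a) ∷ scaleP-*P a p q))
  (≋-reflexive (sym (scaleP-distrib-+P a (scaleP b q) (0ℚ ∷ p *P q))))

*P-assoc : ∀ p q r → (p *P q) *P r ≋ p *P (q *P r)
*P-assoc []      q r = []
*P-assoc (a ∷ p) q r = ≋-trans (*P-distribʳ (scaleP a q) (0ℚ ∷ p *P q) r)
  (+P-cong (scaleP-*P a q r) (≋-trans (0∷-*P (p *P q) r) (0∷-cong (*P-assoc p q r))))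

*P-identityˡ : ∀ p → constP 1ℚ *P p ≋ p
*P-identityˡ p = ≋-trans (constP-*P 1ℚ p) (≋-reflexive (scaleP-identity p))

polyRing : CommutativeRing lzero lzero
polyRing = record
  { Carrier = Poly ; _≈_ = _≋_ ; _+_ = _+P_ ; _*_ = _*P_ ; -_ = negP ; 0# = [] ; 1# = constP 1ℚ
  ; isCommutativeRing = record
    { isRing = record
      { +-isAbelianGroup = record
        { isGroup = record
          { isMonoid = record
            { isSemigroup = record
              { isMagma = record { isEquivalence = ≋-isEquivalence ; ∙-cong = +P-cong }
              ; assoc = λ p q r → ≋-reflexive (+P-assoc p q r) }
            ; identity = (λ _ → ≋-refl) , (λ p → ≋-reflexive (+P-identityʳ p)) }
          ; inverse = (λ p → ≋-trans (≋-reflexive (+P-comm (negP p) p)) (negP-inverseʳ p)) , negP-inverseʳ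
          ; ⁻¹-cong = negP-cong }
        ; comm = λ p q → ≋-reflexive (+P-comm p q) }
      ; *-cong = *P-cong
      ; *-assoc = *P-assoc
      ; *-identity = *P-identityˡ , λ p → ≋-trans (*P-comm p (constP 1ℚ)) (*P-identityˡ p)
      ; distrib = *P-distribˡ , λ r p q → *P-distribʳ p q r }
    ; *-comm = *P-comm } }

polyACR : AlmostCommutativeRing lzero lzero
polyACR = fromCommutativeRing polyRing λ p → Dec.dec⇒maybe ([] ≋? p)

ℚ-ACR : AlmostCommutativeRing lzero lzero
ℚ-ACR = fromCommutativeRing ℚ.+-*-commutativeRing λ x → Dec.dec⇒maybe (0ℚ ℚ.≟ x)

module ≋-Reasoning = SetoidReasoning ≋-setoid

open import Algebra.Properties.CommutativeSemigroup (CommutativeRing.*-commutativeSemigroup polyRing)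
  using (x∙yz≈y∙xz)

norm≡[]⇒≋[] : ∀ {p} → norm p ≡ [] → p ≋ []
norm≡[]⇒≋[] {[]}    _ = []
norm≡[]⇒≋[] {a ∷ p} h with norm p in eq
norm≡[]⇒≋[] {a ∷ p} () | _ ∷ _
norm≡[]⇒≋[] {a ∷ p} h  | [] with a ℚ.≟ 0ℚ
norm≡[]⇒≋[] {a ∷ p} h  | [] | yes a≡0 = ≋-padʳ a≡0 (norm≡[]⇒≋[] eq)
norm≡[]⇒≋[] {a ∷ p} () | [] | no _

isZeroP-false : ∀ {p} → ¬ p ≋ [] → isZeroP p ≡ false
isZeroP-false {p} p≉0 with norm p in eq
... | []    = ⊥-elim (p≉0 (norm≡[]⇒≋[] eq))
... | _ ∷ _ = refl

≋⇒≈P : ∀ {p q} → p ≋ q → p ≈P q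
≋⇒≈P []              = refl
≋⇒≈P (refl ∷ h)      rewrite ≋⇒≈P h = refl
≋⇒≈P (≋-padˡ refl h) rewrite sym (≋⇒≈P h) = refl
≋⇒≈P (≋-padʳ refl h) rewrite ≋⇒≈P h = refl

-- Substituting z² for z

atSquare : Poly → Poly
atSquare []      = []
atSquare (a ∷ p) = a ∷ 0ℚ ∷ atSquare p

atSquare-+P : ∀ p q → atSquare (p +P q) ≡ atSquare p +P atSquare q
atSquare-+P []      q       = refl
atSquare-+P (a ∷ p) []      = refl
atSquare-+P (a ∷ p) (b ∷ q) = cong (λ r → a + b ∷ 0ℚ ∷ r) (atSquare-+P p q)

atSquare-negP : ∀ p → atSquare (negP p) ≡ negP (atSquare p)
atSquare-negP []      = refl
atSquare-negP (a ∷ p) = cong (λ r → - a ∷ 0ℚ ∷ r) (atSquare-negP p)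

atSquare-cong : ∀ {p q} → p ≋ q → atSquare p ≋ atSquare q
atSquare-cong []           = []
atSquare-cong (e ∷ h)      = e ∷ 0∷-cong (atSquare-cong h)
atSquare-cong (≋-padˡ e h) = ≋-padˡ e (≋-padˡ refl (atSquare-cong h))
atSquare-cong (≋-padʳ e h) = ≋-padʳ e (≋-padʳ refl (atSquare-cong h))

atSquare-scaleP : ∀ c p → atSquare (scaleP c p) ≋ scaleP c (atSquare p)
atSquare-scaleP c []      = []
atSquare-scaleP c (a ∷ p) = refl ∷ sym (ℚ.*-zeroʳ c) ∷ atSquare-scaleP c p

atSquare-*P : ∀ p q → atSquare (p *P q) ≋ atSquare p *P atSquare q
atSquare-*P []      q = []
atSquare-*P (a ∷ p) q = begin
  atSquare (scaleP a q +P (0ℚ ∷ p *P q))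
    ≡⟨ atSquare-+P (scaleP a q) (0ℚ ∷ p *P q) ⟩
  atSquare (scaleP a q) +P (0ℚ ∷ 0ℚ ∷ atSquare (p *P q))
    ≈⟨ +P-cong (atSquare-scaleP a q) (0∷-cong (0∷-cong (atSquare-*P p q))) ⟩
  scaleP a (atSquare q) +P (0ℚ ∷ 0ℚ ∷ atSquare p *P atSquare q)
    ≈⟨ +P-congˡ (scaleP a (atSquare q)) (0∷-cong (≋-sym (0∷-*P (atSquare p) (atSquare q)))) ⟩
  atSquare (a ∷ p) *P atSquare q
    ∎
  where open ≋-Reasoning

atSquare-zPow : ∀ n → atSquare (zPow n) ≋ zPow (2 ℕ.* n)
atSquare-zPow zero    = refl ∷ ≋-padʳ refl []
atSquare-zPow (suc n) rewrite ℕ.+-suc n (n ℕ.+ 0) = 0∷-cong (0∷-cong (atSquare-zPow n))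

-- Numerator and denominator of g ℓ

z+1 z-1 : Poly
z+1 = zP +P constP 1ℚ
z-1 = zP -P constP 1ℚ

atSquare-factor : ∀ h → atSquare (num (factor h)) ≋ num (factor (suc h))
atSquare-factor h = begin
  atSquare (1·z^m -P 1·1)
    ≡⟨ trans (atSquare-+P 1·z^m (negP 1·1)) (cong (atSquare 1·z^m +P_) (atSquare-negP 1·1)) ⟩
  atSquare 1·z^m -P atSquare 1·1
    ≈⟨ +P-cong (atSquare-cong (*P-identityˡ (zPow m))) (negP-cong (≋-byComputation (atSquare 1·1) 1·1)) ⟩
  atSquare (zPow m) -P 1·1
    ≈⟨ +P-congʳ (negP 1·1) (≋-trans (atSquare-zPow m) (≋-sym (*P-identityˡ (zPow (2 ℕ.* m))))) ⟩
  constP 1ℚ *P zPow (2 ℕ.* m) -P 1·1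
    ∎
  where
  open ≋-Reasoning
  m = 2 ^ h
  1·z^m = constP 1ℚ *P zPow m
  1·1 = constP 1ℚ *P constP 1ℚ

num-prodFactors-suc : ∀ ℓ → num (prodFactors (suc ℓ)) ≋ z-1 *P atSquare (num (prodFactors ℓ))
num-prodFactors-suc zero    =
  ≋-byComputation (num (prodFactors 1)) (z-1 *P atSquare (num (prodFactors 0)))
num-prodFactors-suc (suc ℓ) = begin
  N′ *P F′                            ≈⟨ *P-cong (num-prodFactors-suc ℓ) (≋-sym (atSquare-factor (suc ℓ))) ⟩
  (z-1 *P atSquare N) *P atSquare F   ≈⟨ *P-assoc z-1 (atSquare N) (atSquare F) ⟩
  z-1 *P (atSquare N *P atSquare F)   ≈⟨ *P-congˡ z-1 (≋-sym (atSquare-*P N F)) ⟩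
  z-1 *P atSquare (N *P F)            ∎
  where
  open ≋-Reasoning
  N = num (prodFactors ℓ)
  F = num (factor (suc ℓ))
  N′ = num (prodFactors (suc ℓ))
  F′ = num (factor (suc (suc ℓ)))

zPow-+ : ∀ m n → zPow m *P zPow n ≋ zPow (m ℕ.+ n)
zPow-+ zero    n = *P-identityˡ (zPow n)
zPow-+ (suc m) n = ≋-trans (0∷-*P (zPow m) (zPow n)) (0∷-cong (zPow-+ m n))

z*den-prodFactors : ∀ ℓ → zP *P den (prodFactors ℓ) ≋ zPow (2 ^ suc ℓ)
z*den-prodFactors zero    = ≋-byComputation (zP *P den (prodFactors 0)) (zPow 2)
z*den-prodFactors (suc ℓ) = begin
  zP *P (D *P (constP 1ℚ *P zPow M))   ≈⟨ ≋-sym (*P-assoc zP D _) ⟩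
  (zP *P D) *P (constP 1ℚ *P zPow M)   ≈⟨ *P-cong (z*den-prodFactors ℓ) (*P-identityˡ (zPow M)) ⟩
  zPow M *P zPow M                     ≈⟨ zPow-+ M M ⟩
  zPow (M ℕ.+ M)                       ≡⟨ cong (λ n → zPow (M ℕ.+ n)) (sym (ℕ.+-identityʳ M)) ⟩
  zPow (2 ^ suc (suc ℓ))               ∎
  where
  open ≋-Reasoning
  D = den (prodFactors ℓ)
  M = 2 ^ suc ℓ

≈RF-common : ∀ {f h} k p q → num f ≋ k *P p → den f ≋ k *P q → num h ≋ p → den h ≋ q → f ≈RF h
≈RF-common {f} {h} k p q num-f den-f num-h den-h = ≋⇒≈P (begin
  num f *P den h        ≈⟨ *P-cong num-f den-h ⟩
  (k *P p) *P q         ≈⟨ regroup k p q ⟩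
  p *P (k *P q)         ≈⟨ *P-cong (≋-sym num-h) (≋-sym den-f) ⟩
  num h *P den f        ∎)
  where
  open ≋-Reasoning
  regroup : ∀ k p q → (k *P p) *P q ≋ p *P (k *P q)
  regroup = solve-∀ polyACR

≈RF-g : ∀ {ℓ f} c → num f ≋ constP c *P num (prodFactors ℓ) → den f ≋ constP c *P zPow (2 ^ suc ℓ) →
        f ≈RF g ℓ
≈RF-g {ℓ} c num-f den-f =
  ≈RF-common (constP c) _ _ num-f den-f (*P-identityˡ (num (prodFactors ℓ))) (z*den-prodFactors ℓ)

-- Degrees, and well-definedness of continued fractions

DegreeBelow : ℕ → Poly → Set
DegreeBelow zero    p       = p ≋ []
DegreeBelow (suc k) []      = ⊤
DegreeBelow (suc k) (a ∷ p) = DegreeBelow k p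

HasDegree : ℕ → Poly → Set
HasDegree zero    []      = ⊥
HasDegree zero    (a ∷ p) = a ≢ 0ℚ × p ≋ []
HasDegree (suc k) []      = ⊥
HasDegree (suc k) (a ∷ p) = HasDegree k p

DegreeBelow-[] : ∀ k → DegreeBelow k []
DegreeBelow-[] zero    = []
DegreeBelow-[] (suc k) = _

DegreeBelow-resp : ∀ k {p q} → p ≋ q → DegreeBelow k p → DegreeBelow k q
DegreeBelow-resp zero    p≋q          p≋0 = ≋-trans (≋-sym p≋q) p≋0
DegreeBelow-resp (suc k) []           _   = _
DegreeBelow-resp (suc k) (_ ∷ p≋q)    d   = DegreeBelow-resp k p≋q d
DegreeBelow-resp (suc k) (≋-padˡ _ h) _   = DegreeBelow-resp k h (DegreeBelow-[] k)
DegreeBelow-resp (suc k) (≋-padʳ _ _) _   = _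

DegreeBelow-suc : ∀ k p → DegreeBelow k p → DegreeBelow (suc k) p
DegreeBelow-suc zero    []      _              = _
DegreeBelow-suc zero    (a ∷ p) (≋-padʳ _ p≋0) = p≋0
DegreeBelow-suc (suc k) []      _              = _
DegreeBelow-suc (suc k) (a ∷ p) d              = DegreeBelow-suc k p d

DegreeBelow-+P : ∀ k p q → DegreeBelow k p → DegreeBelow k q → DegreeBelow k (p +P q)
DegreeBelow-+P zero    p       q       dp dq = +P-cong dp dq
DegreeBelow-+P (suc k) []      q       dp dq = dq
DegreeBelow-+P (suc k) (a ∷ p) []      dp dq = dp
DegreeBelow-+P (suc k) (a ∷ p) (b ∷ q) dp dq = DegreeBelow-+P k p q dp dq

DegreeBelow-scaleP : ∀ k c p → DegreeBelow k p → DegreeBelow k (scaleP c p)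
DegreeBelow-scaleP zero    c p       d = scaleP-congʳ c d
DegreeBelow-scaleP (suc k) c []      d = _
DegreeBelow-scaleP (suc k) c (a ∷ p) d = DegreeBelow-scaleP k c p d

HasDegree⇒≉[] : ∀ k p → HasDegree k p → ¬ p ≋ []
HasDegree⇒≉[] zero    (a ∷ p) (a≢0 , _) (≋-padʳ a≡0 _) = a≢0 a≡0
HasDegree⇒≉[] (suc k) (a ∷ p) d         (≋-padʳ _ p≋0) = HasDegree⇒≉[] k p d p≋0

HasDegree-resp : ∀ k {p q} → p ≋ q → HasDegree k p → HasDegree k q
HasDegree-resp zero    (a≡b ∷ p≋q)      (a≢0 , p≋0) =
  (λ b≡0 → a≢0 (trans a≡b b≡0)) , ≋-trans (≋-sym p≋q) p≋0
HasDegree-resp zero    (≋-padʳ a≡0 _)   (a≢0 , _)   = ⊥-elim (a≢0 a≡0)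
HasDegree-resp (suc k) (_ ∷ p≋q)        d           = HasDegree-resp k p≋q d
HasDegree-resp (suc k) (≋-padʳ _ p≋0) d             = ⊥-elim (HasDegree⇒≉[] k _ d p≋0)

HasDegree⇒DegreeBelow : ∀ k p → HasDegree k p → DegreeBelow (suc k) p
HasDegree⇒DegreeBelow zero    (a ∷ p) (_ , p≋0) = p≋0
HasDegree⇒DegreeBelow (suc k) (a ∷ p) d         = HasDegree⇒DegreeBelow k p d

HasDegree-+P : ∀ k p q → HasDegree k p → DegreeBelow k q → HasDegree k (p +P q)
HasDegree-+P zero    (a ∷ p) []      d           _                 = d
HasDegree-+P zero    (a ∷ p) (b ∷ q) (a≢0 , p≋0) (≋-padʳ refl q≋0) =
  (λ a+0≡0 → a≢0 (trans (sym (ℚ.+-identityʳ a)) a+0≡0)) , +P-cong p≋0 q≋0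
HasDegree-+P (suc k) (a ∷ p) []      d           _ = d
HasDegree-+P (suc k) (a ∷ p) (b ∷ q) d           e = HasDegree-+P k p q d e

HasDegree-scaleP : ∀ k {c} p → c ≢ 0ℚ → HasDegree k p → HasDegree k (scaleP c p)
HasDegree-scaleP zero    {c} (a ∷ p) c≢0 (a≢0 , p≋0) = x#0y#0→xy#0 c≢0 a≢0 , scaleP-congʳ c p≋0
HasDegree-scaleP (suc k)     (a ∷ p) c≢0 d           = HasDegree-scaleP k p c≢0 d

data Linear : Poly → Set where
  linear : ∀ α {β} → β ≢ 0ℚ → Linear (α ∷ β ∷ [])

HasDegree-linear : ∀ k {d q} p → Linear d → HasDegree k q → DegreeBelow k p →
                   HasDegree (suc k) (d *P q +P p)
HasDegree-linear k {q = q} p (linear α {β} β≢0) q-deg p-deg =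
  HasDegree-resp (suc k) rearrange (HasDegree-+P (suc k) (0ℚ ∷ scaleP β q) (scaleP α q +P p)
    (HasDegree-scaleP k q β≢0 q-deg)
    (DegreeBelow-+P (suc k) (scaleP α q) p
      (DegreeBelow-scaleP (suc k) α q (HasDegree⇒DegreeBelow k q q-deg)) (DegreeBelow-suc k p p-deg)))
  where
  rearrange : (0ℚ ∷ scaleP β q) +P (scaleP α q +P p) ≋ (α ∷ β ∷ []) *P q +P p
  rearrange = ≋-trans
    (≋-reflexive (trans (sym (+P-assoc (0ℚ ∷ scaleP β q) (scaleP α q) p))
                        (cong (_+P p) (+P-comm (0ℚ ∷ scaleP β q) (scaleP α q)))))
    (+P-congʳ p (+P-congˡ (scaleP α q) (0∷-cong (≋-sym (constP-*P β q)))))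

data SimpleTerm : Poly × Poly → Set where
  simple : ∀ v {d} → Linear d → SimpleTerm (constP v , d)

-- cfEval without the test for a vanishing denominator.
cfFraction : List (Poly × Poly) → RF
cfFraction []             = [] /ᶠ constP 1ℚ
cfFraction ((b , d) ∷ ts) = let (p /ᶠ q) = cfFraction ts in (b *P q) /ᶠ (d *P q +P p)

cfFraction-degree : ∀ {ts} → All SimpleTerm ts →
  HasDegree (length ts) (den (cfFraction ts)) × DegreeBelow (length ts) (num (cfFraction ts))
cfFraction-degree [] = (ℚ.1≢0 , []) , []
cfFraction-degree {t ∷ ts} (simple v d-linear ∷ terms) =
  HasDegree-linear k (num f) d-linear q-deg p-deg ,
  DegreeBelow-resp (suc k) (≋-sym (constP-*P v (den f)))
    (DegreeBelow-scaleP (suc k) v (den f) (HasDegree⇒DegreeBelow k (den f) q-deg))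
  where
  k = length ts
  f = cfFraction ts
  q-deg = proj₁ (cfFraction-degree terms)
  p-deg = proj₂ (cfFraction-degree terms)

cfEval-cfFraction : ∀ {ts} → All SimpleTerm ts → cfEval ts ≡ just (cfFraction ts)
cfEval-cfFraction []                   = refl
cfEval-cfFraction {t ∷ ts} (s ∷ terms)
  rewrite cfEval-cfFraction terms
        | isZeroP-false (HasDegree⇒≉[] (length (t ∷ ts)) (den (cfFraction (t ∷ ts)))
                                       (proj₁ (cfFraction-degree (s ∷ terms))))
        = refl

z±1 : Bool → Poly
z±1 ev = if ev then z+1 else z-1

z±1-linear : ∀ ev → Linear (z±1 ev)
z±1-linear true  = linear _ ℚ.1≢0
z±1-linear false = linear _ ℚ.1≢0

cfTerms-simple : ∀ ev vs → All SimpleTerm (cfTerms ev vs)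
cfTerms-simple ev []       = []
cfTerms-simple ev (v ∷ vs) = simple v (z±1-linear ev) ∷ cfTerms-simple (not ev) vs

-- Contracting one level of the recursion

divQ-* : ∀ {x y e} → divQ x y ≡ just e → e * y ≡ x
divQ-* {x} {y} eq with y ℚ.≟ 0ℚ
divQ-* {x} {y} ()   | yes _
divQ-* {x} {y} refl | no y≢0 = begin
  x * 1/y * y    ≡⟨ ℚ.*-assoc x 1/y y ⟩
  x * (1/y * y)  ≡⟨ cong (x *_) (ℚ.*-inverseˡ y) ⟩
  x * 1ℚ         ≡⟨ ℚ.*-identityʳ x ⟩
  x              ∎
  where
  open ≡-Reasoning
  instance _ = ≢-nonZero y≢0
  1/y = 1/ y

data StepGraph : Bool → ℚ → List ℚ → List ℚ → Set where
  []  : ∀ {ev o} → StepGraph ev o [] []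
  _∷_ : ∀ {ev o x xs e out} → e * o ≡ - x → StepGraph (not ev) (onePlusSign ev - e) xs out →
        StepGraph ev o (x ∷ xs) (e ∷ onePlusSign ev - e ∷ out)

step⇒StepGraph : ∀ ev o xs {out} → step ev o xs ≡ just out → StepGraph ev o xs out
step⇒StepGraph ev o []       refl = []
step⇒StepGraph ev o (x ∷ xs) eq   with divQ (- x) o in div
step⇒StepGraph ev o (x ∷ xs) ()   | nothing
step⇒StepGraph ev o (x ∷ xs) eq   | just e with step (not ev) (onePlusSign ev - e) xs in rest
step⇒StepGraph ev o (x ∷ xs) ()   | just e | nothing
step⇒StepGraph ev o (x ∷ xs) refl | just e | just _ = divQ-* div ∷ step⇒StepGraph (not ev) _ xs rest

StepGraph-length : ∀ {ev o xs out} → StepGraph ev o xs out → length out ≡ length xs ℕ.+ length xs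
StepGraph-length []                      = refl
StepGraph-length {xs = _ ∷ xs} (_ ∷ g) =
  cong suc (trans (cong suc (StepGraph-length g)) (sym (ℕ.+-suc (length xs) (length xs))))

e*o≡-x⇒x≡-o*e : ∀ {e o x} → e * o ≡ - x → x ≡ - o * e
e*o≡-x⇒x≡-o*e {e} {o} {x} eo≡-x = begin
  x          ≡⟨ involutive x ⟩
  - (- x)    ≡⟨ cong -_ (sym eo≡-x) ⟩
  - (e * o)  ≡⟨ swap e o ⟩
  - o * e    ∎
  where
  open ≡-Reasoning
  involutive : ∀ x → x ≡ - (- x)
  involutive = solve-∀ ℚ-ACR
  swap : ∀ e o → - (e * o) ≡ - o * e
  swap = solve-∀ ℚ-ACR

atSquare-constP : ∀ c → atSquare (constP c) ≋ constP c
atSquare-constP c = refl ∷ ≋-padʳ refl []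

atSquare-z±1 : ∀ ev → atSquare (z±1 ev) ≋ z+1 *P z-1 +P constP (onePlusSign ev)
atSquare-z±1 true  = ≋-byComputation (atSquare z+1) (z+1 *P z-1 +P constP (1ℚ + 1ℚ))
atSquare-z±1 false = ≋-byComputation (atSquare z-1) (z+1 *P z-1 +P constP 0ℚ)

atSquare-cfFraction-num : ∀ v d ts →
  atSquare (num (cfFraction ((constP v , d) ∷ ts))) ≋ constP v *P atSquare (den (cfFraction ts))
atSquare-cfFraction-num v d ts =
  ≋-trans (atSquare-*P (constP v) (den (cfFraction ts))) (*P-congʳ _ (atSquare-constP v))

atSquare-cfFraction-den : ∀ b d ts → let f = cfFraction ts in
  atSquare (den (cfFraction ((b , d) ∷ ts))) ≋ atSquare d *P atSquare (den f) +P atSquare (num f)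
atSquare-cfFraction-den b d ts = ≋-trans
  (≋-reflexive (atSquare-+P (d *P den (cfFraction ts)) (num (cfFraction ts))))
  (+P-congʳ _ (atSquare-*P d (den (cfFraction ts))))

-- For the values Y = y(z) and W = w(z²) the three identities say −W = o·Y / (z − 1 + Y).
Contracts : Bool → ℚ → List ℚ → List ℚ → Set
Contracts ev o xs out =
  ∃[ u ] num y ≋ z-1 *P u × den y ≋ atSquare (den w) -P u × atSquare (num w) ≋ constP (- o) *P u
  where
  y = cfFraction (cfTerms true out)
  w = cfFraction (cfTerms ev xs)

z-1-absorbs : ∀ {y₁ y₂ w u} → y₁ ≋ z-1 *P u → y₂ ≋ w -P u → z-1 *P y₂ +P y₁ ≋ z-1 *P w
z-1-absorbs {y₁} {y₂} {w} {u} y₁≋ y₂≋ = begin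
  z-1 *P y₂ +P y₁                 ≈⟨ +P-cong (*P-congˡ z-1 y₂≋) y₁≋ ⟩
  z-1 *P (w -P u) +P z-1 *P u     ≈⟨ identity z-1 w u ⟩
  z-1 *P w                        ∎
  where
  open ≋-Reasoning
  identity : ∀ M W U → M *P (W +P negP U) +P M *P U ≋ M *P W
  identity = solve-∀ polyACR

StepGraph-contracts : ∀ {ev o xs out} → StepGraph ev o xs out → Contracts ev o xs out
StepGraph-contracts {o = o} [] =
  [] , ≋-sym (*P-zeroʳ z-1) , ≋-byComputation (constP 1ℚ) (atSquare (constP 1ℚ) -P []) ,
  ≋-sym (*P-zeroʳ (constP (- o)))
StepGraph-contracts {ev} {o} {x ∷ xs} {e ∷ _ ∷ out} (eo≡-x ∷ g)
  with u , y₁≋ , y₂≋ , w₁≋ ← StepGraph-contracts g =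
  E *P W₂ , num≋ , den≋ , atSquare-num≋
  where
  open ≋-Reasoning
  o′ = onePlusSign ev - e
  Y₁ = num (cfFraction (cfTerms true out))
  Y₂ = den (cfFraction (cfTerms true out))
  V  = cfFraction (cfTerms (not ev) xs)
  W₁ = atSquare (num V)
  W₂ = atSquare (den V)
  E  = constP e
  C  = constP (onePlusSign ev)

  num≋ : E *P (z-1 *P Y₂ +P Y₁) ≋ z-1 *P (E *P W₂)
  num≋ = ≋-trans (*P-congˡ E (z-1-absorbs y₁≋ y₂≋)) (x∙yz≈y∙xz E z-1 W₂)

  den≋ : z+1 *P (z-1 *P Y₂ +P Y₁) +P constP o′ *P Y₂
         ≋ atSquare (den (cfFraction (cfTerms ev (x ∷ xs)))) -P E *P W₂
  den≋ = begin
    z+1 *P (z-1 *P Y₂ +P Y₁) +P constP o′ *P Y₂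
      ≈⟨ +P-cong (*P-congˡ z+1 (z-1-absorbs y₁≋ y₂≋)) (*P-congˡ (constP o′) y₂≋) ⟩
    z+1 *P (z-1 *P W₂) +P (C -P E) *P (W₂ -P u)
      ≈⟨ identity z+1 z-1 C E W₂ u ⟩
    ((z+1 *P z-1 +P C) *P W₂ +P negP (C -P E) *P u) -P E *P W₂
      ≈⟨ +P-congʳ _ (≋-sym (+P-cong (*P-congʳ W₂ (atSquare-z±1 ev)) w₁≋)) ⟩
    (atSquare (z±1 ev) *P W₂ +P W₁) -P E *P W₂
      ≈⟨ +P-congʳ _ (≋-sym (atSquare-cfFraction-den (constP x) (z±1 ev) (cfTerms (not ev) xs))) ⟩
    atSquare (den (cfFraction (cfTerms ev (x ∷ xs)))) -P E *P W₂
      ∎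
    where
    identity : ∀ P M C E W U →
      P *P (M *P W) +P (C +P negP E) *P (W +P negP U)
        ≋ ((P *P M +P C) *P W +P negP (C +P negP E) *P U) +P negP (E *P W)
    identity = solve-∀ polyACR

  atSquare-num≋ : atSquare (constP x *P den V) ≋ constP (- o) *P (E *P W₂)
  atSquare-num≋ = begin
    atSquare (constP x *P den V)  ≈⟨ atSquare-cfFraction-num x (z±1 ev) (cfTerms (not ev) xs) ⟩
    constP x *P W₂                ≡⟨ cong (λ c → constP c *P W₂) (e*o≡-x⇒x≡-o*e {e} {o} eo≡-x) ⟩
    constP (- o * e) *P W₂        ≈⟨ *P-congʳ W₂ (constP-* (- o) e) ⟩
    (constP (- o) *P E) *P W₂     ≈⟨ *P-assoc (constP (- o)) E W₂ ⟩
    constP (- o) *P (E *P W₂)     ∎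

nextLevel-cfFraction : ∀ {ps out} → StepGraph false (1ℚ + 1ℚ) ps out →
  let v = cfFraction (cfTerms true (1ℚ ∷ ps))
      y = cfFraction (cfTerms true (1ℚ ∷ (1ℚ + 1ℚ) ∷ out))
  in num y ≋ z-1 *P atSquare (num v) × den y ≋ atSquare (den v)
nextLevel-cfFraction {ps} {out} g with u , y₁≋ , y₂≋ , w₁≋ ← StepGraph-contracts g = num≋ , den≋
  where
  open ≋-Reasoning
  Y₁ = num (cfFraction (cfTerms true out))
  Y₂ = den (cfFraction (cfTerms true out))
  V  = cfFraction (cfTerms false ps)
  W₁ = atSquare (num V)
  W₂ = atSquare (den V)
  I  = constP 1ℚ
  T  = constP (1ℚ + 1ℚ)

  num≋ : I *P (z-1 *P Y₂ +P Y₁) ≋ z-1 *P atSquare (I *P den V)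
  num≋ = begin
    I *P (z-1 *P Y₂ +P Y₁)    ≈⟨ *P-congˡ I (z-1-absorbs y₁≋ y₂≋) ⟩
    I *P (z-1 *P W₂)          ≈⟨ x∙yz≈y∙xz I z-1 W₂ ⟩
    z-1 *P (I *P W₂)          ≈⟨ *P-congˡ z-1 (≋-sym (atSquare-cfFraction-num 1ℚ z+1 (cfTerms false ps))) ⟩
    z-1 *P atSquare (I *P den V) ∎

  den≋ : z+1 *P (z-1 *P Y₂ +P Y₁) +P T *P Y₂ ≋ atSquare (z+1 *P den V +P num V)
  den≋ = begin
    z+1 *P (z-1 *P Y₂ +P Y₁) +P T *P Y₂
      ≈⟨ +P-cong (*P-congˡ z+1 (z-1-absorbs y₁≋ y₂≋)) (*P-congˡ T y₂≋) ⟩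
    z+1 *P (z-1 *P W₂) +P T *P (W₂ -P u)
      ≈⟨ identity z+1 z-1 T W₂ u ⟩
    (z+1 *P z-1 +P T) *P W₂ +P negP T *P u
      ≈⟨ ≋-sym (+P-cong (*P-congʳ W₂ (atSquare-z±1 true)) w₁≋) ⟩
    atSquare z+1 *P W₂ +P W₁
      ≈⟨ ≋-sym (atSquare-cfFraction-den I z+1 (cfTerms false ps)) ⟩
    atSquare (z+1 *P den V +P num V)
      ∎
    where
    identity : ∀ P M T W U → P *P (M *P W) +P T *P (W +P negP U) ≋ (P *P M +P T) *P W +P negP T *P U
    identity = solve-∀ polyACR

-- 2-adic valuations

fromℤ-* : ∀ a b → fromℤ (a ℤ.* b) ≡ fromℤ a * fromℤ b
fromℤ-* a b = ℚ.toℚᵘ-injective (ℚᵘ.≃-sym (ℚ.toℚᵘ-homo-* (fromℤ a) (fromℤ b)))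

fromℤ-+ : ∀ a b → fromℤ (a ℤ.+ b) ≡ fromℤ a + fromℤ b
fromℤ-+ a b = ℚ.toℚᵘ-injective
  (ℚᵘ.≃-trans (ℚᵘ.*≡* (identity a b)) (ℚᵘ.≃-sym (ℚ.toℚᵘ-homo-+ (fromℤ a) (fromℤ b))))
  where
  identity : ∀ a b → (a ℤ.+ b) ℤ.* + 1 ≡ (a ℤ.* + 1 ℤ.+ b ℤ.* + 1) ℤ.* + 1
  identity = ℤ-Solver.solve-∀

fromℤ-neg : ∀ a → fromℤ (ℤ.- a) ≡ - fromℤ a
fromℤ-neg a = ℚ.toℚᵘ-injective (ℚᵘ.≃-sym (ℚ.toℚᵘ-homo‿- (fromℤ a)))

Odd : ℤ → Set
Odd a = ∃[ k ] a ≡ + 1 ℤ.+ + 2 ℤ.* k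

Odd-* : ∀ {a b} → Odd a → Odd b → Odd (a ℤ.* b)
Odd-* (k , refl) (l , refl) = k ℤ.+ l ℤ.+ + 2 ℤ.* k ℤ.* l , identity k l
  where
  identity : ∀ k l → (+ 1 ℤ.+ + 2 ℤ.* k) ℤ.* (+ 1 ℤ.+ + 2 ℤ.* l)
                     ≡ + 1 ℤ.+ + 2 ℤ.* (k ℤ.+ l ℤ.+ + 2 ℤ.* k ℤ.* l)
  identity = ℤ-Solver.solve-∀

even-Odd : ∀ c {a} → Odd a → Odd (+ 2 ℤ.* c ℤ.- a)
even-Odd c (k , refl) = c ℤ.- k ℤ.- + 1 , identity c k
  where
  identity : ∀ c k → + 2 ℤ.* c ℤ.- (+ 1 ℤ.+ + 2 ℤ.* k) ≡ + 1 ℤ.+ + 2 ℤ.* (c ℤ.- k ℤ.- + 1)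
  identity = ℤ-Solver.solve-∀

Odd-neg : ∀ {a} → Odd a → Odd (ℤ.- a)
Odd-neg odd = subst Odd (ℤ.+-identityˡ _) (even-Odd 0ℤ odd)

Odd⇒≢0 : ∀ {a} → Odd a → a ≢ 0ℤ
Odd⇒≢0 {a} (k , a≡1+2k) a≡0 = contradiction (ℕ.m*n≡1⇒m≡1 2 ℤ.∣ ℤ.- k ∣ 2∣k∣≡1) λ ()
  where
  identity : ∀ k → + 2 ℤ.* ℤ.- k ≡ + 1 ℤ.- (+ 1 ℤ.+ + 2 ℤ.* k)
  identity = ℤ-Solver.solve-∀
  2∣k∣≡1 : 2 ℕ.* ℤ.∣ ℤ.- k ∣ ≡ 1
  2∣k∣≡1 = trans (sym (ℤ.abs-* (+ 2) (ℤ.- k)))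
                 (cong ℤ.∣_∣ (trans (identity k) (cong (λ i → + 1 ℤ.- i) (trans (sym a≡1+2k) a≡0))))

-- Val₂ n q: q has 2-adic valuation −n.
data Val₂ (n : ℕ) (q : ℚ) : Set where
  val₂ : ∀ a b → Odd a → Odd b → q * fromℤ ((+ 2) ℤ.^ n ℤ.* b) ≡ fromℤ a → Val₂ n q

Val₂⇒≢0 : ∀ {n q} → Val₂ n q → q ≢ 0ℚ
Val₂⇒≢0 {n} (val₂ a b odd-a _ eq) refl =
  Odd⇒≢0 odd-a (cong ↥_ (trans (sym eq) (ℚ.*-zeroˡ (fromℤ ((+ 2) ℤ.^ n ℤ.* b)))))

cross-multiply : ∀ {e o x P Q Bo Bx Ao Ax} → e * o ≡ - x → o * (Q * Bo) ≡ Ao → x * ((P * Q) * Bx) ≡ Ax →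
       e * (P * (Ao * Bx)) ≡ - (Ax * Bo)
cross-multiply {e} {o} {x} {P} {Q} {Bo} {Bx} {Ao} {Ax} eo≡-x ho hx = begin
  e * (P * (Ao * Bx))                  ≡⟨ cong (λ t → e * (P * (t * Bx))) (sym ho) ⟩
  e * (P * ((o * (Q * Bo)) * Bx))      ≡⟨ regroup₁ e o P Q Bo Bx ⟩
  (e * o) * (((P * Q) * Bx) * Bo)      ≡⟨ cong (_* (((P * Q) * Bx) * Bo)) eo≡-x ⟩
  - x * (((P * Q) * Bx) * Bo)          ≡⟨ regroup₂ x (P * Q * Bx) Bo ⟩
  - ((x * ((P * Q) * Bx)) * Bo)        ≡⟨ cong (λ t → - (t * Bo)) hx ⟩
  - (Ax * Bo)                          ∎
  where
  open ≡-Reasoning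
  regroup₁ : ∀ e o P Q Bo Bx → e * (P * ((o * (Q * Bo)) * Bx)) ≡ (e * o) * (((P * Q) * Bx) * Bo)
  regroup₁ = solve-∀ ℚ-ACR
  regroup₂ : ∀ x R Bo → - x * (R * Bo) ≡ - ((x * R) * Bo)
  regroup₂ = solve-∀ ℚ-ACR

Val₂-÷ : ∀ k {n e o x} → e * o ≡ - x → Val₂ (k ℕ.+ n) x → Val₂ n o → Val₂ k e
Val₂-÷ k {n} {e} {o} {x} eo≡-x (val₂ ax bx odd-ax odd-bx hx) (val₂ ao bo odd-ao odd-bo ho) =
  val₂ (ℤ.- (ax ℤ.* bo)) (ao ℤ.* bx) (Odd-neg (Odd-* odd-ax odd-bo)) (Odd-* odd-ao odd-bx) (begin
    e * fromℤ (2ᵏ ℤ.* (ao ℤ.* bx))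
      ≡⟨ cong (e *_) (trans (fromℤ-* 2ᵏ _) (cong (fromℤ 2ᵏ *_) (fromℤ-* ao bx))) ⟩
    e * (fromℤ 2ᵏ * (fromℤ ao * fromℤ bx))
      ≡⟨ cross-multiply {e} {o} {x} {fromℤ 2ᵏ} {fromℤ 2ⁿ} {fromℤ bo} {fromℤ bx} eo≡-x ho′ hx′ ⟩
    - (fromℤ ax * fromℤ bo)                ≡⟨ cong -_ (sym (fromℤ-* ax bo)) ⟩
    - fromℤ (ax ℤ.* bo)                    ≡⟨ sym (fromℤ-neg (ax ℤ.* bo)) ⟩
    fromℤ (ℤ.- (ax ℤ.* bo))                ∎)
  where
  open ≡-Reasoning
  2ᵏ = (+ 2) ℤ.^ k
  2ⁿ = (+ 2) ℤ.^ n
  ho′ : o * (fromℤ 2ⁿ * fromℤ bo) ≡ fromℤ ao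
  ho′ = trans (cong (o *_) (sym (fromℤ-* 2ⁿ bo))) ho
  2ᵏ⁺ⁿbx≡ : fromℤ ((+ 2) ℤ.^ (k ℕ.+ n) ℤ.* bx) ≡ (fromℤ 2ᵏ * fromℤ 2ⁿ) * fromℤ bx
  2ᵏ⁺ⁿbx≡ = begin
    fromℤ ((+ 2) ℤ.^ (k ℕ.+ n) ℤ.* bx)  ≡⟨ cong (λ t → fromℤ (t ℤ.* bx)) (ℤ.^-distribˡ-+-* (+ 2) k n) ⟩
    fromℤ ((2ᵏ ℤ.* 2ⁿ) ℤ.* bx)          ≡⟨ fromℤ-* (2ᵏ ℤ.* 2ⁿ) bx ⟩
    fromℤ (2ᵏ ℤ.* 2ⁿ) * fromℤ bx        ≡⟨ cong (_* fromℤ bx) (fromℤ-* 2ᵏ 2ⁿ) ⟩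
    (fromℤ 2ᵏ * fromℤ 2ⁿ) * fromℤ bx    ∎
  hx′ : x * ((fromℤ 2ᵏ * fromℤ 2ⁿ) * fromℤ bx) ≡ fromℤ ax
  hx′ = trans (cong (x *_) (sym 2ᵏ⁺ⁿbx≡)) hx

Val₂-even- : ∀ c {n e} → Val₂ n e → Val₂ n (fromℤ (+ 2 ℤ.* c) - e)
Val₂-even- c {n} {e} (val₂ a b odd-a odd-b h) =
  val₂ (2cB ℤ.- a) b (even-Odd (c ℤ.* B) odd-a) odd-b (begin
    (fromℤ (+ 2 ℤ.* c) - e) * fromℤ B          ≡⟨ distrib (fromℤ (+ 2 ℤ.* c)) e (fromℤ B) ⟩
    fromℤ (+ 2 ℤ.* c) * fromℤ B - e * fromℤ B  ≡⟨ cong₂ _-_ (sym (fromℤ-* (+ 2 ℤ.* c) B)) h ⟩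
    fromℤ ((+ 2 ℤ.* c) ℤ.* B) - fromℤ a        ≡⟨ cong (λ t → fromℤ t - fromℤ a) (ℤ.*-assoc (+ 2) c B) ⟩
    fromℤ 2cB - fromℤ a                        ≡⟨ cong (λ t → fromℤ 2cB + t) (sym (fromℤ-neg a)) ⟩
    fromℤ 2cB + fromℤ (ℤ.- a)                  ≡⟨ sym (fromℤ-+ 2cB (ℤ.- a)) ⟩
    fromℤ (2cB ℤ.- a)                          ∎)
  where
  open ≡-Reasoning
  B = (+ 2) ℤ.^ n ℤ.* b
  2cB = + 2 ℤ.* (c ℤ.* B)
  distrib : ∀ C e B → (C - e) * B ≡ C * B - e * B
  distrib = solve-∀ ℚ-ACR

Val₂-onePlusSign- : ∀ s {n e} → Val₂ n e → Val₂ n (onePlusSign s - e)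
Val₂-onePlusSign- true  {n} {e} = Val₂-even- (+ 1) {n} {e}
Val₂-onePlusSign- false {n} {e} = Val₂-even- 0ℤ {n} {e}

odd-1 : Odd (+ 1)
odd-1 = 0ℤ , refl

odd-−1 : Odd -[1+ 0 ]
odd-−1 = -[1+ 0 ] , refl

val₂-1 : Val₂ 0 1ℚ
val₂-1 = val₂ (+ 1) (+ 1) odd-1 odd-1 refl

val₂-−1 : Val₂ 0 (- 1ℚ)
val₂-−1 = val₂ -[1+ 0 ] (+ 1) odd-−1 odd-1 refl

val₂-½ : Val₂ 1 ½
val₂-½ = val₂ (+ 1) (+ 1) odd-1 odd-1 refl

val₂-−½ : Val₂ 1 -½
val₂-−½ = val₂ -[1+ 0 ] (+ 1) odd-−1 odd-1 refl

-- The shape of each level after its initial 1, 2; it keeps every division in step by a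
-- nonzero number.
data Admissible : List ℚ → Set where
  []   : Admissible []
  unit : ∀ {x xs} → Val₂ 0 x → Admissible xs → Admissible (x ∷ xs)
  pair : ∀ {x y xs} → Val₂ 1 x → Val₂ 1 y → Admissible xs → Admissible (x ∷ y ∷ xs)

Admissible⇒nonzero : ∀ {xs} → Admissible xs → All (_≢ 0ℚ) xs
Admissible⇒nonzero []             = []
Admissible⇒nonzero (unit vx a)    = Val₂⇒≢0 vx ∷ Admissible⇒nonzero a
Admissible⇒nonzero (pair vx vy a) = Val₂⇒≢0 vx ∷ Val₂⇒≢0 vy ∷ Admissible⇒nonzero a

divQ-defined : ∀ x {y} → y ≢ 0ℚ → ∃[ e ] divQ x y ≡ just e
divQ-defined x {y} y≢0 with y ℚ.≟ 0ℚ
... | yes y≡0 = contradiction y≡0 y≢0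
... | no _    = _ , refl

step-∷ : ∀ ev {o x} xs {e rest} →
         divQ (- x) o ≡ just e → step (not ev) (onePlusSign ev - e) xs ≡ just rest →
         step ev o (x ∷ xs) ≡ just (e ∷ onePlusSign ev - e ∷ rest)
step-∷ ev xs d s rewrite d | s = refl

step-admissible : ∀ ev {o xs} → Val₂ 0 o → Admissible xs →
                  ∃[ out ] step ev o xs ≡ just out × Admissible out
step-admissible ev vo [] = [] , refl , []
step-admissible ev {o} {x ∷ xs} vo (unit vx a) =
  let e , d = divQ-defined (- x) (Val₂⇒≢0 vo)
      ve = Val₂-÷ 0 (divQ-* d) vx vo
      vo′ = Val₂-onePlusSign- ev ve
      rest , s , a′ = step-admissible (not ev) vo′ a
  in _ , step-∷ ev xs d s , unit ve (unit vo′ a′)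
step-admissible ev {o} {x ∷ y ∷ xs} vo (pair vx vy a) =
  let e₁ , d₁ = divQ-defined (- x) (Val₂⇒≢0 vo)
      ve₁ = Val₂-÷ 1 (divQ-* d₁) vx vo
      vo₁ = Val₂-onePlusSign- ev ve₁
      e₂ , d₂ = divQ-defined (- y) (Val₂⇒≢0 vo₁)
      ve₂ = Val₂-÷ 0 (divQ-* d₂) vy vo₁
      vo₂ = Val₂-onePlusSign- (not ev) ve₂
      rest , s , a′ = step-admissible (not (not ev)) vo₂ a
  in _ , step-∷ ev (y ∷ xs) d₁ (step-∷ (not ev) xs d₂ s) , pair ve₁ vo₁ (unit ve₂ (unit vo₂ a′))

-- Partial quotients

-- A total inverse, with the junk value 0⁻¹ = 0.
_⁻¹ : ℚ → ℚ
q ⁻¹ with q ℚ.≟ 0ℚ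
... | yes _   = 0ℚ
... | no q≢0 = 1/ q
  where instance _ = ≢-nonZero q≢0

⁻¹-inverseˡ : ∀ {q} → q ≢ 0ℚ → q ⁻¹ * q ≡ 1ℚ
⁻¹-inverseˡ {q} q≢0 with q ℚ.≟ 0ℚ
... | yes q≡0 = contradiction q≡0 q≢0
... | no q≢0′ = ℚ.*-inverseˡ q
  where instance _ = ≢-nonZero q≢0′

⁻¹-≢0 : ∀ {q} → q ≢ 0ℚ → q ⁻¹ ≢ 0ℚ
⁻¹-≢0 {q} q≢0 q⁻¹≡0 =
  ℚ.1≢0 (trans (sym (⁻¹-inverseˡ q≢0)) (trans (cong (_* q) q⁻¹≡0) (ℚ.*-zeroˡ q)))

-- c is the scalar of the previous partial quotient (1 at the start): with cⱼ = (vⱼ cⱼ₋₁)⁻¹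
-- the numerator vⱼ of the transformed continued fraction becomes cⱼ₋₁ cⱼ vⱼ = 1.
partialQuotients : Bool → ℚ → List ℚ → List Poly
partialQuotients ev c []       = []
partialQuotients ev c (v ∷ vs) = scaleP c′ (z±1 ev) ∷ partialQuotients (not ev) c′ vs
  where c′ = (v * c) ⁻¹

unitNumerators : List Poly → List (Poly × Poly)
unitNumerators = map (constP 1ℚ ,_)

Linear-scaleP : ∀ {c d} → c ≢ 0ℚ → Linear d → Linear (scaleP c d)
Linear-scaleP c≢0 (linear α β≢0) = linear _ (x#0y#0→xy#0 c≢0 β≢0)

Linear⇒DegreeOne : ∀ {d} → Linear d → DegreeOne d
Linear⇒DegreeOne (linear α {β} β≢0) with β ℚ.≟ 0ℚ
... | yes β≡0 = contradiction β≡0 β≢0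
... | no _    = refl

partialQuotients-linear : ∀ ev {c} vs → c ≢ 0ℚ → All (_≢ 0ℚ) vs →
                          All Linear (partialQuotients ev c vs)
partialQuotients-linear ev []       c≢0 []           = []
partialQuotients-linear ev (v ∷ vs) c≢0 (v≢0 ∷ vs≢0) =
  Linear-scaleP c′≢0 (z±1-linear ev) ∷ partialQuotients-linear (not ev) vs c′≢0 vs≢0
  where c′≢0 = ⁻¹-≢0 (x#0y#0→xy#0 v≢0 c≢0)

unitNumerators-simple : ∀ {as} → All Linear as → All SimpleTerm (unitNumerators as)
unitNumerators-simple []       = []
unitNumerators-simple (l ∷ ls) = simple 1ℚ l ∷ unitNumerators-simple ls

partialQuotients-cfFraction : ∀ ev {c} vs → c ≢ 0ℚ → All (_≢ 0ℚ) vs →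
  let f = cfFraction (cfTerms ev vs)
      h = cfFraction (unitNumerators (partialQuotients ev c vs))
  in ∃[ μ ] num h ≋ constP (c * μ) *P num f × den h ≋ constP μ *P den f
partialQuotients-cfFraction ev {c} [] c≢0 [] =
  1ℚ , ≋-sym (*P-zeroʳ (constP (c * 1ℚ))) , ≋-sym (*P-identityˡ (constP 1ℚ))
partialQuotients-cfFraction ev {c} (v ∷ vs) c≢0 (v≢0 ∷ vs≢0) = c′ * μ′ , num≋′ , den≋′
  where
  vc≢0 = x#0y#0→xy#0 v≢0 c≢0
  c′ = (v * c) ⁻¹
  ih = partialQuotients-cfFraction (not ev) vs (⁻¹-≢0 vc≢0) vs≢0
  μ′ = proj₁ ih
  num≋ = proj₁ (proj₂ ih)
  den≋ = proj₂ (proj₂ ih)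
  d = z±1 ev
  f = cfFraction (cfTerms (not ev) vs)
  h = cfFraction (unitNumerators (partialQuotients (not ev) c′ vs))

  μ′≡ : μ′ ≡ c * (c′ * μ′) * v
  μ′≡ = begin
    μ′                  ≡⟨ sym (ℚ.*-identityˡ μ′) ⟩
    1ℚ * μ′             ≡⟨ cong (_* μ′) (sym (⁻¹-inverseˡ vc≢0)) ⟩
    c′ * (v * c) * μ′   ≡⟨ regroup c′ v c μ′ ⟩
    c * (c′ * μ′) * v   ∎
    where
    open ≡-Reasoning
    regroup : ∀ c′ v c μ′ → c′ * (v * c) * μ′ ≡ c * (c′ * μ′) * v
    regroup = solve-∀ ℚ-ACR

  num≋′ : constP 1ℚ *P den h ≋ constP (c * (c′ * μ′)) *P (constP v *P den f)
  num≋′ = begin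
    constP 1ℚ *P den h                 ≈⟨ *P-identityˡ (den h) ⟩
    den h                              ≈⟨ den≋ ⟩
    constP μ′ *P den f                 ≡⟨ cong (λ t → constP t *P den f) μ′≡ ⟩
    constP (cμ * v) *P den f           ≈⟨ *P-congʳ (den f) (constP-* cμ v) ⟩
    (constP cμ *P constP v) *P den f   ≈⟨ *P-assoc (constP cμ) (constP v) (den f) ⟩
    constP cμ *P (constP v *P den f)   ∎
    where
    open ≋-Reasoning
    cμ = c * (c′ * μ′)

  den≋′ : scaleP c′ d *P den h +P num h ≋ constP (c′ * μ′) *P (d *P den f +P num f)
  den≋′ = begin
    scaleP c′ d *P den h +P num h
      ≈⟨ +P-cong (*P-cong (≋-sym (constP-*P c′ d)) den≋)
                 (≋-trans num≋ (*P-congʳ (num f) (constP-* c′ μ′))) ⟩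
    (constP c′ *P d) *P (constP μ′ *P den f) +P (constP c′ *P constP μ′) *P num f
      ≈⟨ regroup (constP c′) (constP μ′) d (den f) (num f) ⟩
    (constP c′ *P constP μ′) *P (d *P den f +P num f)
      ≈⟨ *P-congʳ _ (≋-sym (constP-* c′ μ′)) ⟩
    constP (c′ * μ′) *P (d *P den f +P num f)
      ∎
    where
    open ≋-Reasoning
    regroup : ∀ C L d Q P → (C *P d) *P (L *P Q) +P (C *P L) *P P ≋ (C *P L) *P (d *P Q +P P)
    regroup = solve-∀ polyACR

-- The levels of the recursion

record Level (ℓ : ℕ) : Set where
  field
    tail    : List ℚ
    vals≡   : vals ℓ ≡ just (1ℚ ∷ tail)
    length≡ : length (1ℚ ∷ tail) ≡ 2 ^ suc ℓ
    nonzero : All (_≢ 0ℚ) (1ℚ ∷ tail)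
    num≋    : num (cfFraction (cfTerms true (1ℚ ∷ tail))) ≋ num (prodFactors ℓ)
    den≋    : den (cfFraction (cfTerms true (1ℚ ∷ tail))) ≋ zPow (2 ^ suc ℓ)
    next    : ∃[ out ] step false (1ℚ + 1ℚ) tail ≡ just out × Admissible out

level-zero : Level zero
level-zero = record
  { tail    = 1ℚ ∷ []
  ; vals≡   = refl
  ; length≡ = refl
  ; nonzero = ℚ.1≢0 ∷ ℚ.1≢0 ∷ []
  ; num≋    = ≋-byComputation _ _
  ; den≋    = ≋-byComputation _ _
  ; next    = -½ ∷ ½ ∷ [] , refl , pair val₂-−½ val₂-½ []
  }

level-suc : ∀ {ℓ} → Level ℓ → Level (suc ℓ)
level-suc {ℓ} L = record
  { tail    = 1ℚ + 1ℚ ∷ out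
  ; vals≡   = vals≡′
  ; length≡ = length≡′
  ; nonzero = ℚ.1≢0 ∷ (λ ()) ∷ Admissible⇒nonzero admissible
  ; num≋    = ≋-trans (proj₁ (nextLevel-cfFraction graph))
                (≋-trans (*P-congˡ z-1 (atSquare-cong num≋)) (≋-sym (num-prodFactors-suc ℓ)))
  ; den≋    = ≋-trans (proj₂ (nextLevel-cfFraction graph))
                (≋-trans (atSquare-cong den≋) (atSquare-zPow (2 ^ suc ℓ)))
  ; next    = next′
  }
  where
  open Level L
  out = proj₁ next
  stepped = proj₁ (proj₂ next)
  admissible = proj₂ (proj₂ next)
  graph = step⇒StepGraph false (1ℚ + 1ℚ) tail stepped

  vals≡′ : vals (suc ℓ) ≡ just (1ℚ ∷ 1ℚ + 1ℚ ∷ out)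
  vals≡′ rewrite vals≡ | stepped = refl

  length≡′ : length (1ℚ ∷ 1ℚ + 1ℚ ∷ out) ≡ 2 ^ suc (suc ℓ)
  length≡′ = begin
    suc (suc (length out))                     ≡⟨ cong (suc ∘ suc) (StepGraph-length graph) ⟩
    suc (suc (length tail ℕ.+ length tail))    ≡⟨ cong suc (sym (ℕ.+-suc (length tail) (length tail))) ⟩
    suc (length tail) ℕ.+ suc (length tail)    ≡⟨ cong₂ ℕ._+_ length≡ (trans length≡ (sym (ℕ.+-identityʳ _))) ⟩
    2 ^ suc (suc ℓ)                            ∎
    where open ≡-Reasoning

  -- The next level begins by dividing −2 by 2, which leaves the 2-adic units −1 and 0 − (−1) = 1.
  next′ : ∃[ out′ ] step false (1ℚ + 1ℚ) (1ℚ + 1ℚ ∷ out) ≡ just out′ × Admissible out′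
  next′ =
    let rest , stepped′ , admissible′ = step-admissible true val₂-1 admissible
    in - 1ℚ ∷ 1ℚ ∷ rest , step-∷ false {1ℚ + 1ℚ} {1ℚ + 1ℚ} out { - 1ℚ} refl stepped′ ,
       unit val₂-−1 (unit val₂-1 admissible′)

level : ∀ ℓ → Level ℓ
level zero    = level-zero
level (suc ℓ) = level-suc (level ℓ)

theorem2p2 : (ℓ : ℕ) →
    Σ (List _) (λ vs → vals ℓ ≡ just vs × length vs ≡ 2 ^ suc ℓ
    × Σ RF (λ K → cfEval (cfTerms true vs) ≡ just K × K ≈RF g ℓ))
    × Σ (List Poly) (λ as → All DegreeOne as
    × Σ RF (λ K → cf0 as ≡ just K × K ≈RF g ℓ))
theorem2p2 ℓ =
  (vs , vals≡ , length≡ , _ , cfEval-cfFraction (cfTerms-simple true vs) ,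
    ≈RF-g {ℓ} 1ℚ (≋-trans num≋ (≋-sym (*P-identityˡ _))) (≋-trans den≋ (≋-sym (*P-identityˡ _)))) ,
  (as , All.map Linear⇒DegreeOne linear-as , _ , cfEval-cfFraction (unitNumerators-simple linear-as) ,
    ≈RF-g {ℓ} μ (≋-trans num-h (*P-cong (≋-reflexive (cong constP (ℚ.*-identityˡ μ))) num≋))
            (≋-trans den-h (*P-congˡ (constP μ) den≋)))
  where
  open Level (level ℓ)
  vs = 1ℚ ∷ tail
  as = partialQuotients true 1ℚ vs
  linear-as = partialQuotients-linear true vs ℚ.1≢0 nonzero
  scaled = partialQuotients-cfFraction true vs ℚ.1≢0 nonzero
  μ = proj₁ scaled
  num-h = proj₁ (proj₂ scaled)
  den-h = proj₂ (proj₂ scaled)
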